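{- Let $x,y$ be positive integers and $a,b$ nonnegative integers. Then $$(x+y+a)!\,b!+(x+y+b)!\,a!>(x+a)!\,(y+b)!+(x+b)!\,(y+a)!.$$ -}

module Defs where

{-# OPTIONS --safe #-}
module Submission where

-- Multiply through by a! b!. The ratios (k + p)! / p! grow with p, so the pairs
-- ((x + a)! b!, (x + b)! a!) and ((y + a)! b!, (y + b)! a!) are ordered the same way
-- (both according to a ≤ b), and the rearrangement inequality bounds the left-hand side
-- by b!² (x + a)! (y + a)! + a!² (x + b)! (y + b)!. Each of these products is in turn
-- strictly smaller than the corresponding term on the right, because
-- (x + a)! (y + a)! < (x + y + a)! a! when x, y > 0.

open import Defs
open import Data.Nat using (ℕ; zero; suc; _+_; _*_; _≤_; _<_; s≤s; _!)
open import Data.Nat.Properties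
open import Data.Nat.Tactic.RingSolver using (solve-∀)
open import Data.Product using (_×_; _,_)
open import Data.Sum as Sum using (_⊎_; inj₁; inj₂)
open import Relation.Binary.PropositionalEquality using (_≡_; refl; sym; subst; subst₂)

[k+p]!*q!≤[k+q]!*p! : ∀ k {p q} → p ≤ q → (k + p) ! * q ! ≤ (k + q) ! * p !
[k+p]!*q!≤[k+q]!*p! zero {p} {q} p≤q = ≤-reflexive (*-comm (p !) (q !))
[k+p]!*q!≤[k+q]!*p! (suc k) {p} {q} p≤q = begin
  suc (k + p) * (k + p) ! * q !    ≡⟨ *-assoc (suc (k + p)) ((k + p) !) (q !) ⟩
  suc (k + p) * ((k + p) ! * q !)  ≤⟨ *-monoʳ-≤ (suc (k + p)) ([k+p]!*q!≤[k+q]!*p! k p≤q) ⟩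
  suc (k + p) * ((k + q) ! * p !)  ≤⟨ *-monoˡ-≤ _ (s≤s (+-monoʳ-≤ k p≤q)) ⟩
  suc (k + q) * ((k + q) ! * p !)  ≡⟨ *-assoc (suc (k + q)) ((k + q) !) (p !) ⟨
  suc (k + q) * (k + q) ! * p !    ∎
  where open ≤-Reasoning

[1+k+p]!*q!<[1+k+q]!*p! : ∀ k {p q} → p < q → (suc k + p) ! * q ! < (suc k + q) ! * p !
[1+k+p]!*q!<[1+k+q]!*p! k {p} {q} p<q = begin-strict
  suc (k + p) * (k + p) ! * q !    ≡⟨ *-assoc (suc (k + p)) ((k + p) !) (q !) ⟩
  suc (k + p) * ((k + p) ! * q !)  ≤⟨ *-monoʳ-≤ (suc (k + p)) ([k+p]!*q!≤[k+q]!*p! k (<⇒≤ p<q)) ⟩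
  suc (k + p) * ((k + q) ! * p !)  <⟨ *-monoˡ-< _ {{(k + q) !* p !≢0}} (s≤s (+-monoʳ-< k p<q)) ⟩
  suc (k + q) * ((k + q) ! * p !)  ≡⟨ *-assoc (suc (k + q)) ((k + q) !) (p !) ⟨
  suc (k + q) * (k + q) ! * p !    ∎
  where open ≤-Reasoning

[x+a]!*[y+a]!<[x+y+a]!*a! : ∀ {x y} a → 0 < x → 0 < y → (x + a) ! * (y + a) ! < (x + y + a) ! * a !
[x+a]!*[y+a]!<[x+y+a]!*a! {suc x} {y} a _ 0<y =
  subst (λ n → (suc x + a) ! * (y + a) ! < suc n ! * a !) (sym (+-assoc x y a))
    ([1+k+p]!*q!<[1+k+q]!*p! x (m<n+m a 0<y))

*-rearrangement : ∀ {P Q R S} → P ≤ Q → R ≤ S → P * S + Q * R ≤ P * R + Q * S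
*-rearrangement {P} {_} {R} P≤Q R≤S with m≤n⇒∃[o]m+o≡n P≤Q | m≤n⇒∃[o]m+o≡n R≤S
... | u , refl | v , refl = subst (P * (R + v) + (P + u) * R ≤_) (regroup P R u v) (m≤m+n _ (u * v))
  where
  regroup : ∀ P R u v → P * (R + v) + (P + u) * R + u * v ≡ P * R + (P + u) * (R + v)
  regroup = solve-∀

similarly-ordered-rearrangement : ∀ {P Q R S} → (P ≤ Q × R ≤ S) ⊎ (Q ≤ P × S ≤ R) →
  P * S + Q * R ≤ P * R + Q * S
similarly-ordered-rearrangement (inj₁ (P≤Q , R≤S)) = *-rearrangement P≤Q R≤S
similarly-ordered-rearrangement {P} {Q} {R} {S} (inj₂ (Q≤P , S≤R)) =
  subst₂ _≤_ (+-comm (Q * R) (P * S)) (+-comm (Q * S) (P * R)) (*-rearrangement Q≤P S≤R)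

factorial-rearrangement : ∀ x y a b →
  (x + a) ! * b ! * ((y + b) ! * a !) + (x + b) ! * a ! * ((y + a) ! * b !) ≤
  (x + a) ! * b ! * ((y + a) ! * b !) + (x + b) ! * a ! * ((y + b) ! * a !)
factorial-rearrangement x y a b = similarly-ordered-rearrangement (Sum.map ordered ordered (≤-total a b))
  where
  ordered : ∀ {p q} → p ≤ q → (x + p) ! * q ! ≤ (x + q) ! * p ! × (y + p) ! * q ! ≤ (y + q) ! * p !
  ordered p≤q = [k+p]!*q!≤[k+q]!*p! x p≤q , [k+p]!*q!≤[k+q]!*p! y p≤q

lemma2p4 : (x y a b : ℕ) → 0 < x → 0 < y →
    (x + a) ! * (y + b) ! + (x + b) ! * (y + a) ! < (x + y + a) ! * b ! + (x + y + b) ! * a !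
lemma2p4 x y a b 0<x 0<y = *-cancelˡ-< (a ! * b !) _ _ (begin-strict
  a ! * b ! * ((x + a) ! * (y + b) ! + (x + b) ! * (y + a) !)
    ≡⟨ regroupˡ (a !) (b !) ((x + a) !) ((x + b) !) ((y + a) !) ((y + b) !) ⟩
  (x + a) ! * b ! * ((y + b) ! * a !) + (x + b) ! * a ! * ((y + a) ! * b !)
    ≤⟨ factorial-rearrangement x y a b ⟩
  (x + a) ! * b ! * ((y + a) ! * b !) + (x + b) ! * a ! * ((y + b) ! * a !)
    ≡⟨ regroupᵐ (a !) (b !) ((x + a) !) ((x + b) !) ((y + a) !) ((y + b) !) ⟩
  (x + a) ! * (y + a) ! * (b ! * b !) + (x + b) ! * (y + b) ! * (a ! * a !)
    <⟨ +-mono-<-≤ (*-monoˡ-< _ {{b !* b !≢0}} ([x+a]!*[y+a]!<[x+y+a]!*a! a 0<x 0<y))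
                  (*-monoˡ-≤ _ (<⇒≤ ([x+a]!*[y+a]!<[x+y+a]!*a! b 0<x 0<y))) ⟩
  (x + y + a) ! * a ! * (b ! * b !) + (x + y + b) ! * b ! * (a ! * a !)
    ≡⟨ regroupʳ (a !) (b !) ((x + y + a) !) ((x + y + b) !) ⟩
  a ! * b ! * ((x + y + a) ! * b ! + (x + y + b) ! * a !) ∎)
  where
  open ≤-Reasoning
  instance _ = a !* b !≢0
  regroupˡ : ∀ A B fa fb ga gb → A * B * (fa * gb + fb * ga) ≡ fa * B * (gb * A) + fb * A * (ga * B)
  regroupˡ = solve-∀
  regroupᵐ : ∀ A B fa fb ga gb → fa * B * (ga * B) + fb * A * (gb * A) ≡ fa * ga * (B * B) + fb * gb * (A * A)
  regroupᵐ = solve-∀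
  regroupʳ : ∀ A B ha hb → ha * A * (B * B) + hb * B * (A * A) ≡ A * B * (ha * B + hb * A)
  regroupʳ = solve-∀
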